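{- Every existentially closed co-Brouwerian semilattice $L$ satisfies the Density 1 Axiom: for every $c\in L$ there exists $b\in L$, $b\neq 0$, such that $c\ll b$.
   Context: A co-Brouwerian semilattice (CBS) is a poset with least element $0$, binary joins $\vee$ and a difference $-$ characterized by $a-b\le c$ iff $a\le b\vee c$. $a\ll b$ means $a\le b$ and $b-a=b$. A CBS $L$ is existentially closed if for every CBS $B\supseteq L$ (superstructure in signature $(0,\vee,-)$), every existential sentence with parameters in $L$ true in $B$ is true in $L$. -}

module Defs where

open import Data.Nat using (ℕ)
open import Data.Fin using (Fin)
open import Data.Product using (Σ; _×_)
open import Data.Sum using (_⊎_)
open import Relation.Nullary using (¬_)
open import Relation.Binary.PropositionalEquality using (_≡_)

record CBS : Set₁ where
  infix  4 _≤_
  infixl 6 _∨_ _-_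
  field
    Carrier   : Set
    _≤_       : Carrier → Carrier → Set
    ≤-refl    : ∀ {a} → a ≤ a
    ≤-trans   : ∀ {a b c} → a ≤ b → b ≤ c → a ≤ c
    ≤-antisym : ∀ {a b} → a ≤ b → b ≤ a → a ≡ b
    𝟘         : Carrier
    𝟘-least   : ∀ {a} → 𝟘 ≤ a
    _∨_       : Carrier → Carrier → Carrier
    ∨-ub₁     : ∀ {a b} → a ≤ a ∨ b
    ∨-ub₂     : ∀ {a b} → b ≤ a ∨ b
    ∨-lub     : ∀ {a b c} → a ≤ c → b ≤ c → a ∨ b ≤ c
    _-_       : Carrier → Carrier → Carrier
    diff→     : ∀ {a b c} → a - b ≤ c → a ≤ b ∨ c
    diff←     : ∀ {a b c} → a ≤ b ∨ c → a - b ≤ c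

  _≪_ : Carrier → Carrier → Set
  a ≪ b = (a ≤ b) × (b - a ≡ b)

open CBS

record Embedding (L B : CBS) : Set where
  field
    map      : Carrier L → Carrier B
    injective : ∀ {a b} → map a ≡ map b → a ≡ b
    pres-𝟘   : map (𝟘 L) ≡ 𝟘 B
    pres-∨   : ∀ a b → map (_∨_ L a b) ≡ _∨_ B (map a) (map b)
    pres--   : ∀ a b → map (_-_ L a b) ≡ _-_ B (map a) (map b)

data Term (n : ℕ) (P : Set) : Set where
  var  : Fin n → Term n P
  par  : P → Term n P
  zer  : Term n P
  join : Term n P → Term n P → Term n P
  dif  : Term n P → Term n P → Term n P

data QF (n : ℕ) (P : Set) : Set where
  eq  : Term n P → Term n P → QF n P
  tt  : QF n P
  ff  : QF n P
  neg : QF n P → QF n P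
  and : QF n P → QF n P → QF n P
  or  : QF n P → QF n P → QF n P

module _ (B : CBS) {n : ℕ} {P : Set} (π : P → Carrier B) (ρ : Fin n → Carrier B) where
  evalT : Term n P → Carrier B
  evalT (var i)    = ρ i
  evalT (par p)    = π p
  evalT zer        = 𝟘 B
  evalT (join s t) = _∨_ B (evalT s) (evalT t)
  evalT (dif s t)  = _-_ B (evalT s) (evalT t)

  data ⊤' : Set where
    ⋆ : ⊤'
  data ⊥' : Set where

  Sat : QF n P → Set
  Sat (eq s t)  = evalT s ≡ evalT t
  Sat tt        = ⊤'
  Sat ff        = ⊥'
  Sat (neg φ)   = ¬ Sat φ
  Sat (and φ ψ) = Sat φ × Sat ψ
  Sat (or φ ψ)  = Sat φ ⊎ Sat ψ

HoldsIn : (L B : CBS) → Embedding L B → (n : ℕ) → QF n (Carrier L) → Set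
HoldsIn L B e n φ = Σ (Fin n → Carrier B) λ ρ → Sat B (Embedding.map e) ρ φ

HoldsInSelf : (L : CBS) → (n : ℕ) → QF n (Carrier L) → Set
HoldsInSelf L n φ = Σ (Fin n → Carrier L) λ ρ → Sat L (λ x → x) ρ φ

ExistentiallyClosed : CBS → Set₁
ExistentiallyClosed L =
  (B : CBS) (e : Embedding L B) (n : ℕ) (φ : QF n (Carrier L)) →
  HoldsIn L B e n φ → HoldsInSelf L n φ

-- Adjoin a new top element ⊤⁺ to L: joins with ⊤⁺ are ⊤⁺, subtracting ⊤⁺ gives 0
-- and ⊤⁺ minus anything old is ⊤⁺.  This is a CBS extending L in which ⊤⁺ is a
-- nonzero element with c ≪ ⊤⁺ for every c, and that fact is an existential sentence
-- with parameter c, so existential closedness pulls a witness back into L.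
module Submission where

open import Defs
open import Data.Fin using (Fin; zero)
open import Data.Product using (Σ; _×_; _,_)
open import Relation.Binary.PropositionalEquality using (_≡_; _≢_; refl; subst)
open import Relation.Nullary.Construct.Add.Supremum using (_⁺; ⊤⁺; [_]; []-injective)
import Relation.Binary.Construct.Add.Supremum.NonStrict as AddSupremum

module _ (L : CBS) where
  open CBS L

  ∨-absorbs⇒≤ : ∀ {a b} → a ∨ b ≡ b → a ≤ b
  ∨-absorbs⇒≤ a∨b≡b = subst (_ ≤_) a∨b≡b ∨-ub₁

module WithTop (L : CBS) where
  open CBS L
  open AddSupremum _≤_

  infixl 6 _∨⁺_ _-⁺_

  _∨⁺_ : Carrier ⁺ → Carrier ⁺ → Carrier ⁺
  [ a ] ∨⁺ [ b ] = [ a ∨ b ]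
  [ a ] ∨⁺ ⊤⁺    = ⊤⁺
  ⊤⁺    ∨⁺ b     = ⊤⁺

  _-⁺_ : Carrier ⁺ → Carrier ⁺ → Carrier ⁺
  a     -⁺ ⊤⁺    = [ 𝟘 ]
  [ a ] -⁺ [ b ] = [ a - b ]
  ⊤⁺    -⁺ [ b ] = ⊤⁺

  𝟘-least⁺ : ∀ {a} → [ 𝟘 ] ≤⁺ a
  𝟘-least⁺ {[ a ]} = [ 𝟘-least ]
  𝟘-least⁺ {⊤⁺}    = _ ≤⊤⁺

  ∨⁺-ub₁ : ∀ {a b} → a ≤⁺ a ∨⁺ b
  ∨⁺-ub₁ {[ a ]} {[ b ]} = [ ∨-ub₁ ]
  ∨⁺-ub₁ {[ a ]} {⊤⁺}    = _ ≤⊤⁺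
  ∨⁺-ub₁ {⊤⁺}            = _ ≤⊤⁺

  ∨⁺-ub₂ : ∀ {a b} → b ≤⁺ a ∨⁺ b
  ∨⁺-ub₂ {[ a ]} {[ b ]} = [ ∨-ub₂ ]
  ∨⁺-ub₂ {[ a ]} {⊤⁺}    = _ ≤⊤⁺
  ∨⁺-ub₂ {⊤⁺}            = _ ≤⊤⁺

  ∨⁺-lub : ∀ {a b c} → a ≤⁺ c → b ≤⁺ c → a ∨⁺ b ≤⁺ c
  ∨⁺-lub [ a≤c ] [ b≤c ] = [ ∨-lub a≤c b≤c ]
  ∨⁺-lub (_ ≤⊤⁺) _       = _ ≤⊤⁺

  diff⁺→ : ∀ {a b c} → a -⁺ b ≤⁺ c → a ≤⁺ b ∨⁺ c
  diff⁺→ {[ a ]} {[ b ]} {[ c ]} [ a-b≤c ] = [ diff→ a-b≤c ]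
  diff⁺→ {[ a ]} {[ b ]} {⊤⁺}    _         = _ ≤⊤⁺
  diff⁺→ {⊤⁺}    {[ b ]} {⊤⁺}    _         = _ ≤⊤⁺
  diff⁺→ {a}     {⊤⁺}            _         = _ ≤⊤⁺

  diff⁺← : ∀ {a b c} → a ≤⁺ b ∨⁺ c → a -⁺ b ≤⁺ c
  diff⁺← {[ a ]} {[ b ]} {[ c ]} [ a≤b∨c ] = [ diff← a≤b∨c ]
  diff⁺← {[ a ]} {[ b ]} {⊤⁺}    _         = _ ≤⊤⁺
  diff⁺← {⊤⁺}    {[ b ]} {⊤⁺}    _         = _ ≤⊤⁺
  diff⁺← {a}     {⊤⁺}            _         = 𝟘-least⁺

  withTop : CBS
  withTop = record
    { Carrier   = Carrier ⁺
    ; _≤_       = _≤⁺_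
    ; ≤-refl    = ≤⁺-reflexive-≡ (λ { refl → ≤-refl }) refl
    ; ≤-trans   = ≤⁺-trans ≤-trans
    ; ≤-antisym = ≤⁺-antisym-≡ ≤-antisym
    ; 𝟘         = [ 𝟘 ]
    ; 𝟘-least   = 𝟘-least⁺
    ; _∨_       = _∨⁺_
    ; ∨-ub₁     = ∨⁺-ub₁
    ; ∨-ub₂     = ∨⁺-ub₂
    ; ∨-lub     = ∨⁺-lub
    ; _-_       = _-⁺_
    ; diff→     = diff⁺→
    ; diff←     = diff⁺←
    }

  [-]-embedding : Embedding L withTop
  [-]-embedding = record
    { map       = [_]
    ; injective = []-injective
    ; pres-𝟘    = refl
    ; pres-∨    = λ _ _ → refl
    ; pres--    = λ _ _ → refl
    }

nonzero-≫ : {P : Set} → P → QF 1 P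
nonzero-≫ c = and (neg (eq x zer)) (and (eq (join (par c) x) x) (eq (dif x (par c)) x))
  where x = var zero

sat-nonzero-≫ : (L : CBS) (c : CBS.Carrier L) (ρ : Fin 1 → CBS.Carrier L) →
  Sat L (λ a → a) ρ (nonzero-≫ c) → (ρ zero ≢ CBS.𝟘 L) × CBS._≪_ L c (ρ zero)
sat-nonzero-≫ L c ρ (x≢𝟘 , c∨x≡x , x-c≡x) = x≢𝟘 , ∨-absorbs⇒≤ L c∨x≡x , x-c≡x

⊤⁺-nonzero-≫ : (L : CBS) (c : CBS.Carrier L) →
  HoldsIn L (WithTop.withTop L) (WithTop.[-]-embedding L) 1 (nonzero-≫ c)
⊤⁺-nonzero-≫ L c = (λ _ → ⊤⁺) , (λ ()) , refl , refl

theorem4p7 : (L : CBS) → ExistentiallyClosed L →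
    (c : CBS.Carrier L) → Σ (CBS.Carrier L) λ b → (b ≢ CBS.𝟘 L) × CBS._≪_ L c b
theorem4p7 L ec c with ec (WithTop.withTop L) (WithTop.[-]-embedding L) 1 (nonzero-≫ c)
                          (⊤⁺-nonzero-≫ L c)
... | ρ , sat = ρ zero , sat-nonzero-≫ L c ρ sat
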